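{- Let $G=(V,E)$ and the algorithm be as described in the context. In any stable configuration, the set $M=\{(i,j)\in E : p_i=j,\ p_j=i,\ m_i=m_j=\text{true}\}$ is a maximal matching of $G$, i.e. no two edges of $M$ share an endpoint, and no edge of $E\setminus M$ can be added to $M$ while keeping this property.
   Context: Let $G=(V,E)$ be a finite simple undirected graph; each node is a process and $N(i)$ denotes the set of neighbours of $i$. Each process has an identifier from a totally ordered set; identifiers of any two distinct processes at distance at most $2$ are distinct, and comparisons such as $j>i$ between processes are comparisons of their identifiers. Each process $i$ holds variables $m_i\in\{\text{true},\text{false}\}$ and $p_i\in\{null\}\cup N(i)$; a configuration is an assignment of values to all these variables. Define the predicate $PRmarried(i)\equiv \exists j\in N(i): (p_i=j \text{ and } p_j=i)$. The algorithm consists of the following four guarded rules for each process $i$ (a rule is enabled at $i$ if its guard holds): Update: if $m_i\neq PRmarried(i)$ then $m_i:=PRmarried(i)$. Marriage: if $m_i=PRmarried(i)$ and $p_i=null$ and there is $j\in N(i)$ with $p_j=i$, then $p_i:=j$ (for such a $j$). Seduction: if $m_i=PRmarried(i)$ and $p_i=null$ and $p_k\neq i$ for all $k\in N(i)$ and there is $j\in N(i)$ with $p_j=null$, $j>i$ and $m_j=\text{false}$, then $p_i:=\max\{j\in N(i): p_j=null,\ j>i,\ m_j=\text{false}\}$. Abandonment: if $m_i=PRmarried(i)$ and $p_i=j\neq null$ and $p_j\neq i$ and ($m_j=\text{true}$ or $j\le i$), then $p_i:=null$. A process is eligible if some rule is enabled at it. A configuration is stable if no process is eligible. -}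

module Defs where

open import Data.Nat using (ℕ; _<_; _≤_)
open import Data.Fin using (Fin)
open import Data.Bool using (Bool; true; false)
open import Data.Maybe using (Maybe; just; nothing)
open import Data.Product using (Σ; ∃; _×_; _,_)
open import Data.Sum using (_⊎_)
open import Relation.Nullary using (¬_)
open import Relation.Binary.PropositionalEquality using (_≡_; _≢_)

record Graph (n : ℕ) : Set₁ where
  field
    Adj   : Fin n → Fin n → Set
    sym   : ∀ {i j} → Adj i j → Adj j i
    irrefl : ∀ {i} → ¬ Adj i i
open Graph public

record Ids {n : ℕ} (G : Graph n) : Set where
  field
    id    : Fin n → ℕ
    dist1 : ∀ {i j} → Adj G i j → id i ≢ id j
    dist2 : ∀ {i k j} → Adj G i k → Adj G k j → i ≢ j → id i ≢ id j
open Ids public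

-- A configuration: m_i ∈ Bool, p_i ∈ {null} ∪ N(i) (null = nothing).
record Config {n : ℕ} (G : Graph n) : Set where
  field
    m     : Fin n → Bool
    p     : Fin n → Maybe (Fin n)
    p-nbr : ∀ {i j} → p i ≡ just j → Adj G i j
open Config public

module Algorithm {n : ℕ} (G : Graph n) (I : Ids G) (c : Config G) where

  _>ᵢ_ : Fin n → Fin n → Set
  j >ᵢ i = id I i < id I j

  _≤ᵢ_ : Fin n → Fin n → Set
  j ≤ᵢ i = id I j ≤ id I i

  PRmarried : Fin n → Set
  PRmarried i = Σ (Fin n) λ j → Adj G i j × p c i ≡ just j × p c j ≡ just i

  MOk : Fin n → Set
  MOk i = (m c i ≡ true → PRmarried i) × (PRmarried i → m c i ≡ true)

  UpdateEnabled : Fin n → Set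
  UpdateEnabled i = ¬ MOk i

  MarriageEnabled : Fin n → Set
  MarriageEnabled i = MOk i × p c i ≡ nothing ×
    Σ (Fin n) λ j → Adj G i j × p c j ≡ just i

  SeductionEnabled : Fin n → Set
  SeductionEnabled i = MOk i × p c i ≡ nothing ×
    (∀ k → Adj G i k → p c k ≢ just i) ×
    Σ (Fin n) λ j → Adj G i j × p c j ≡ nothing × j >ᵢ i × m c j ≡ false

  AbandonmentEnabled : Fin n → Set
  AbandonmentEnabled i = MOk i × Σ (Fin n) λ j → p c i ≡ just j ×
    p c j ≢ just i × (m c j ≡ true ⊎ j ≤ᵢ i)

  Eligible : Fin n → Set
  Eligible i = UpdateEnabled i ⊎ MarriageEnabled i ⊎ SeductionEnabled i ⊎ AbandonmentEnabled i

  Stable : Set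
  Stable = ∀ i → ¬ Eligible i

  InM : Fin n → Fin n → Set
  InM i j = Adj G i j × p c i ≡ just j × p c j ≡ just i × m c i ≡ true × m c j ≡ true

record IsMatching {n : ℕ} (G : Graph n) (M : Fin n → Fin n → Set) : Set where
  field
    ⊆E       : ∀ {i j} → M i j → Adj G i j
    symmetric : ∀ {i j} → M i j → M j i
    disjoint  : ∀ {i j k} → M i j → M i k → j ≡ k

record IsMaximalMatching {n : ℕ} (G : Graph n) (M : Fin n → Fin n → Set) : Set where
  field
    matching : IsMatching G M
    maximal  : ∀ {i j} → Adj G i j → ¬ M i j →
               (Σ (Fin n) λ k → M i k) ⊎ (Σ (Fin n) λ k → M j k)

module Submission where

open import Defs
open import Data.Nat using (ℕ; _<_)
open import Data.Nat.Properties using (<-cmp; ≰⇒>; <-isStrictPartialOrder)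
open import Data.Fin using (Fin; _≟_)
open import Data.Fin.Induction using (spo-noetherian)
open import Data.Bool using (true; false)
import Data.Bool as Bool
open import Data.Bool.Properties using (¬-not)
open import Data.Maybe using (just; nothing)
open import Data.Maybe.Properties using (≡-dec; just-injective)
open import Data.Product using (Σ; _×_; _,_; proj₁; proj₂)
open import Data.Sum using (_⊎_; inj₁; inj₂)
open import Data.Empty using (⊥; ⊥-elim)
open import Induction.WellFounded using (WellFounded; Acc; acc)
open import Relation.Nullary using (¬_; Dec; yes; no)
open import Relation.Nullary.Decidable using (_×-dec_; _→-dec_; decidable-stable)
open import Relation.Binary.Definitions using (tri<; tri≈; tri>)
open import Relation.Binary.PropositionalEquality using (_≡_; _≢_; refl; trans) renaming (sym to ≡-sym)
import Relation.Binary.Construct.On as On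

-- In a stable configuration the guard m_i = PRmarried(i) holds everywhere, and every
-- unmarried process i has p_i = null: otherwise p_i = j with j not pointing back, and
-- since Abandonment is disabled, j is unmarried with a larger identifier; by induction
-- along increasing identifiers (which is well-founded, there being finitely many
-- processes) p_j = null, so Marriage is enabled at j. Hence two adjacent unmarried
-- processes would enable Seduction at the smaller one, so every edge has a married
-- endpoint, and married pairs are exactly the edges of M.

ascending-wellFounded : ∀ {n} (f : Fin n → ℕ) → WellFounded (λ j i → f i < f j)
ascending-wellFounded f = spo-noetherian (On.isStrictPartialOrder f <-isStrictPartialOrder)

module _ {n : ℕ} {G : Graph n} (I : Ids G) (c : Config G) where
  open Algorithm G I c

  PRmarried? : ∀ i → Dec (PRmarried i)
  PRmarried? i with p c i in pᵢ≡
  ... | nothing = no λ { (_ , _ , () , _) }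
  ... | just k with ≡-dec _≟_ (p c k) (just i)
  ...   | yes pₖ≡i = yes (k , p-nbr c pᵢ≡ , refl , pₖ≡i)
  ...   | no  pₖ≢i = no λ { (_ , _ , refl , pₖ≡i) → pₖ≢i pₖ≡i }

  MOk? : ∀ i → Dec (MOk i)
  MOk? i = (m c i Bool.≟ true →-dec PRmarried? i) ×-dec (PRmarried? i →-dec m c i Bool.≟ true)

  InM-isMatching : IsMatching G InM
  InM-isMatching = record
    { ⊆E        = proj₁
    ; symmetric = λ { (adj , pᵢ≡j , pⱼ≡i , mᵢ , mⱼ) → Graph.sym G adj , pⱼ≡i , pᵢ≡j , mⱼ , mᵢ }
    ; disjoint  = λ { (_ , pᵢ≡j , _) (_ , pᵢ≡k , _) → just-injective (trans (≡-sym pᵢ≡j) pᵢ≡k) }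
    }

  module _ (stable : Stable) where

    mOk : ∀ i → MOk i
    mOk i = decidable-stable (MOk? i) (λ ¬ok → stable i (inj₁ ¬ok))

    PRmarried⇒m≡true : ∀ {i} → PRmarried i → m c i ≡ true
    PRmarried⇒m≡true {i} = proj₂ (mOk i)

    ¬PRmarried⇒m≡false : ∀ {i} → ¬ PRmarried i → m c i ≡ false
    ¬PRmarried⇒m≡false {i} ¬pr = ¬-not (λ mᵢ → ¬pr (proj₁ (mOk i) mᵢ))

    m≡false⇒¬PRmarried : ∀ {i} → m c i ≡ false → ¬ PRmarried i
    m≡false⇒¬PRmarried mᵢ≡false pr with () ← trans (≡-sym mᵢ≡false) (PRmarried⇒m≡true pr)

    PRmarried⇒InM : ∀ {i} → PRmarried i → Σ (Fin n) (InM i)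
    PRmarried⇒InM {i} prᵢ@(j , adj , pᵢ≡j , pⱼ≡i) =
      j , adj , pᵢ≡j , pⱼ≡i , PRmarried⇒m≡true prᵢ , PRmarried⇒m≡true prⱼ
      where
      prⱼ : PRmarried j
      prⱼ = i , Graph.sym G adj , pⱼ≡i , pᵢ≡j

    null⇒¬courted : ∀ {i j} → p c i ≡ nothing → Adj G i j → p c j ≢ just i
    null⇒¬courted {i} {j} pᵢ≡null adj pⱼ≡i =
      stable i (inj₂ (inj₁ (mOk i , pᵢ≡null , j , adj , pⱼ≡i)))

    unrequited⇒higher-unmarried : ∀ {i j} → p c i ≡ just j → p c j ≢ just i →
                                  m c j ≡ false × j >ᵢ i
    unrequited⇒higher-unmarried {i} {j} pᵢ≡j pⱼ≢i =
        ¬-not (λ mⱼ → abandon (inj₁ mⱼ))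
      , ≰⇒> (λ j≤i → abandon (inj₂ j≤i))
      where
      abandon : m c j ≡ true ⊎ j ≤ᵢ i → ⊥
      abandon reason = stable i (inj₂ (inj₂ (inj₂ (mOk i , j , pᵢ≡j , pⱼ≢i , reason))))

    ¬PRmarried⇒null : ∀ {i} → ¬ PRmarried i → p c i ≡ nothing
    ¬PRmarried⇒null {i} = go i (ascending-wellFounded (id I) i)
      where
      go : ∀ i → Acc _>ᵢ_ i → ¬ PRmarried i → p c i ≡ nothing
      go i (acc higher) ¬prᵢ with p c i in pᵢ≡j
      ... | nothing = refl
      ... | just j = ⊥-elim (null⇒¬courted pⱼ≡null (Graph.sym G (p-nbr c pᵢ≡j)) pᵢ≡j)
        where
        -- the with-abstraction has turned p_i into just j inside ¬prᵢ
        pⱼ≢i : p c j ≢ just i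
        pⱼ≢i pⱼ≡i = ¬prᵢ (j , p-nbr c pᵢ≡j , refl , pⱼ≡i)
        pⱼ≡null : p c j ≡ nothing
        pⱼ≡null with mⱼ≡false , j>i ← unrequited⇒higher-unmarried pᵢ≡j pⱼ≢i
          = go j (higher j>i) (m≡false⇒¬PRmarried mⱼ≡false)

    ¬seducible : ∀ {i j} → Adj G i j → j >ᵢ i → ¬ PRmarried i → ¬ PRmarried j → ⊥
    ¬seducible {i} {j} adj j>i ¬prᵢ ¬prⱼ = stable i (inj₂ (inj₂ (inj₁
      (mOk i , pᵢ≡null , (λ _ → null⇒¬courted pᵢ≡null) ,
       j , adj , ¬PRmarried⇒null ¬prⱼ , j>i , ¬PRmarried⇒m≡false ¬prⱼ))))
      where
      pᵢ≡null : p c i ≡ nothing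
      pᵢ≡null = ¬PRmarried⇒null ¬prᵢ

    adjacent-¬PRmarried-absurd : ∀ {i j} → Adj G i j → ¬ PRmarried i → ¬ PRmarried j → ⊥
    adjacent-¬PRmarried-absurd {i} {j} adj ¬prᵢ ¬prⱼ with <-cmp (id I i) (id I j)
    ... | tri< i<j _ _ = ¬seducible adj i<j ¬prᵢ ¬prⱼ
    ... | tri≈ _ i≡j _ = dist1 I adj i≡j
    ... | tri> _ _ j<i = ¬seducible (Graph.sym G adj) j<i ¬prⱼ ¬prᵢ

    InM-covers-edges : ∀ {i j} → Adj G i j → Σ (Fin n) (InM i) ⊎ Σ (Fin n) (InM j)
    InM-covers-edges {i} {j} adj with PRmarried? i | PRmarried? j
    ... | yes prᵢ | _       = inj₁ (PRmarried⇒InM prᵢ)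
    ... | no _    | yes prⱼ = inj₂ (PRmarried⇒InM prⱼ)
    ... | no ¬prᵢ | no ¬prⱼ = ⊥-elim (adjacent-¬PRmarried-absurd adj ¬prᵢ ¬prⱼ)

theorem1 : ∀ {n : ℕ} (G : Graph n) (I : Ids G) (c : Config G) →
    Algorithm.Stable G I c → IsMaximalMatching G (Algorithm.InM G I c)
theorem1 G I c stable = record
  { matching = InM-isMatching I c
  ; maximal  = λ adj _ → InM-covers-edges I c stable adj
  }
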